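{- If $f:\mathbb{F}_2^n\to\mathbb{F}_2$ is an $(n,k,p)$-function, then $g=f\oplus\mathcal{L}_n$, where $\mathcal{L}_n(x)=x_1\oplus\cdots\oplus x_n$, is an $[n,k,n-p-1]$-function.
   Context: The real polynomial degree $\mathrm{pdeg}(f)$ of $f:\{0,1\}^n\to\{0,1\}$ is the degree of the unique multilinear real polynomial agreeing with $f$ on $\{0,1\}^n$. The Walsh transform is $W_f(\mathbf{u})=\sum_{\mathbf{x}\in\mathbb{F}_2^n}(-1)^{f(\mathbf{x})\oplus \mathbf{u}\cdot\mathbf{x}}$; $f$ is $m$-resilient if $W_f(\mathbf{u})=0$ for all $\mathbf{u}$ of Hamming weight at most $m$. For $S\subseteq[n]$, $\mathbf{x}^{(S)}$ is $\mathbf{x}$ with the bits in $S$ flipped. $f$ is $k$-th order sensitive if there is $\mathbf{x}$ with $f(\mathbf{x})\neq f(\mathbf{x}^{(S)})$ for all $S$ with $1\le|S|\le k$. $g$ is $k$-th order dual sensitive if there is $\mathbf{x}$ such that for every $1\le j\le k$ and every $|S|=j$: $g(\mathbf{x})\ne g(\mathbf{x}^{(S)})$ if $j$ is even and $g(\mathbf{x})=g(\mathbf{x}^{(S)})$ if $j$ is odd. An $(n,k,p)$-function is an $n$-variable Boolean function that is $k$-th order sensitive and has real polynomial degree at most $p$. An $[n,k,m]$-function is an $n$-variable Boolean function that is $k$-th order dual sensitive and $m$-resilient.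
   Formalization: The multilinear polynomial witnessing that $\mathrm{pdeg}(f)$ is at most p is taken with rational coefficients instead of real ones. -}

module Defs where

open import Data.Bool using (Bool; true; false; _xor_; _∧_; if_then_else_)
open import Data.Nat using (ℕ; zero; suc; _≤_; _+_)
open import Data.Integer as ℤ using (ℤ; +_; -[1+_])
open import Data.Rational as ℚ using (ℚ)
open import Data.List using (List; []; _∷_; map; _++_; foldr)
open import Data.Vec using (Vec; []; _∷_; zipWith)
open import Data.Product using (∃; _×_)
open import Relation.Binary.PropositionalEquality using (_≡_; _≢_)

BoolFun : ℕ → Set
BoolFun n = Vec Bool n → Bool

allVecs : (n : ℕ) → List (Vec Bool n)
allVecs zero    = [] ∷ []
allVecs (suc n) = map (false ∷_) (allVecs n) ++ map (true ∷_) (allVecs n)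

-- Hamming weight (also cardinality of a subset S ⊆ [n] given as indicator vector).
wt : ∀ {n} → Vec Bool n → ℕ
wt []           = 0
wt (false ∷ xs) = wt xs
wt (true ∷ xs)  = suc (wt xs)

dot : ∀ {n} → Vec Bool n → Vec Bool n → Bool
dot []       []       = false
dot (u ∷ us) (x ∷ xs) = (u ∧ x) xor dot us xs

flip : ∀ {n} → Vec Bool n → Vec Bool n → Vec Bool n
flip x S = zipWith _xor_ x S

Lin : ∀ n → BoolFun n
Lin zero    []       = false
Lin (suc n) (x ∷ xs) = x xor Lin n xs

_⊕L : ∀ {n} → BoolFun n → BoolFun n
(f ⊕L) x = f x xor Lin _ x

sgn : Bool → ℤ
sgn false = + 1
sgn true  = -[1+ 0 ]

sumℤ : List ℤ → ℤ
sumℤ = foldr ℤ._+_ (+ 0)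

sumℚ : List ℚ → ℚ
sumℚ = foldr ℚ._+_ ℚ.0ℚ

walsh : ∀ {n} → BoolFun n → Vec Bool n → ℤ
walsh {n} f u = sumℤ (map (λ x → sgn (f x xor dot u x)) (allVecs n))

-- m-resilient (m an integer, so that m = -1 gives the vacuous condition)
Resilient : ∀ {n} → BoolFun n → ℤ → Set
Resilient {n} f m = ∀ (u : Vec Bool n) → + (wt u) ℤ.≤ m → walsh f u ≡ + 0

Sensitive : ∀ {n} → BoolFun n → ℕ → Set
Sensitive {n} f k = ∃ λ (x : Vec Bool n) → ∀ (S : Vec Bool n) →
  1 ≤ wt S → wt S ≤ k → f x ≢ f (flip x S)

odd : ℕ → Bool
odd zero    = false
odd (suc n) = if odd n then false else true

DualSensitive : ∀ {n} → BoolFun n → ℕ → Set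
DualSensitive {n} g k = ∃ λ (x : Vec Bool n) → ∀ (S : Vec Bool n) →
  1 ≤ wt S → wt S ≤ k →
  (odd (wt S) ≡ false → g x ≢ g (flip x S)) ×
  (odd (wt S) ≡ true  → g x ≡ g (flip x S))

bitℚ : Bool → ℚ
bitℚ false = ℚ.0ℚ
bitℚ true  = ℚ.1ℚ

monomial : ∀ {n} → Vec Bool n → Vec Bool n → ℚ
monomial []           []       = ℚ.1ℚ
monomial (false ∷ S)  (x ∷ xs) = monomial S xs
monomial (true ∷ S)   (x ∷ xs) = bitℚ x ℚ.* monomial S xs

evalPoly : ∀ {n} → (Vec Bool n → ℚ) → Vec Bool n → ℚ
evalPoly {n} c x = sumℚ (map (λ S → c S ℚ.* monomial S x) (allVecs n))

-- pdeg(f) ≤ p : the (unique) multilinear polynomial agreeing with f on {0,1}^n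
-- has degree ≤ p, i.e. there is a multilinear polynomial with no monomial of
-- degree > p that agrees with f on {0,1}^n.
PdegAtMost : ∀ {n} → BoolFun n → ℕ → Set
PdegAtMost {n} f p = ∃ λ (c : Vec Bool n → ℚ) →
  (∀ S → p Data.Nat.< wt S → c S ≡ ℚ.0ℚ) × (∀ x → evalPoly c x ≡ bitℚ (f x))

NKPFunction : ∀ n → ℕ → ℕ → BoolFun n → Set
NKPFunction n k p f = Sensitive f k × PdegAtMost f p

NKMFunction : ∀ n → ℕ → ℤ → BoolFun n → Set
NKMFunction n k m g = DualSensitive g k × Resilient g m

-- Flipping the bits in S changes Lₙ by |S| mod 2, so at a
-- point where f is sensitive to every S with 1 ≤ |S| ≤ k, g changes exactly
-- when |S| is even. For resilience, (-1)^{Lₙ(x)} (-1)^{u·x} = (-1)^{ū·x} with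
-- ū the complement of u, so W_g(u) = W_f(ū) and wt ū = n - wt u ≥ p + 1.
-- Writing (-1)^f = 1 - 2f and expanding f = Σ_S c_S x^S, W_f(v) becomes a
-- combination of the character sums Σ_x x^S (-1)^{v·x}, and such a sum
-- vanishes whenever v ⊄ S, in particular whenever wt S < wt v.
module Submission where

open import Defs
open import Data.Nat using (ℕ)
open import Data.Integer using (+_; _-_)

open import Algebra using (CommutativeMonoid; CommutativeRing)
import Algebra.Properties.CommutativeSemigroup as CommSemigroupProperties
open import Data.Bool using (Bool; true; false; _xor_; _∧_; not)
open import Data.Bool.Properties
  using (xor-assoc; xor-identityʳ; xor-same; not-distribˡ-xor; ¬-not; xor-∧-commutativeRing)
import Data.Nat as ℕ
import Data.Nat.Properties as ℕP
import Data.Integer as ℤ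
import Data.Integer.Properties as ℤP
open import Data.Integer.Solver using (module +-*-Solver)
open import Data.Rational as ℚ using (ℚ; 0ℚ; 1ℚ; mkℚ; ↥_; _+_; _*_)
import Data.Rational.Properties as ℚP
import Data.Rational.Unnormalised as ℚᵘ
import Data.Rational.Unnormalised.Properties as ℚᵘP
open import Data.Nat.Coprimality using (1-coprimeTo)
import Data.Nat.Coprimality as Coprimality
open import Data.List using (List; []; _∷_; map; _++_)
import Data.List.Properties as ListP
open import Data.Vec using (Vec; []; _∷_; replicate)
open import Data.Fin.Subset using (∁)
open import Data.Product using (_,_; _×_)
open import Relation.Binary.PropositionalEquality
open import Relation.Nullary using (yes; no)
open import Function using (_∘_)

open CommSemigroupProperties (CommutativeRing.+-commutativeSemigroup xor-∧-commutativeRing)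
  using () renaming (interchange to xor-interchange)
open CommSemigroupProperties (CommutativeMonoid.commutativeSemigroup ℚP.+-0-commutativeMonoid)
  using () renaming (interchange to +-interchange)
open CommSemigroupProperties (CommutativeMonoid.commutativeSemigroup ℚP.*-1-commutativeMonoid)
  using () renaming (interchange to *-interchange; x∙yz≈y∙xz to *-left-comm)

odd-suc : ∀ m → odd (ℕ.suc m) ≡ not (odd m)
odd-suc m with odd m
... | true  = refl
... | false = refl

odd-wt-∷ : ∀ {n} s (S : Vec Bool n) → odd (wt (s ∷ S)) ≡ s xor odd (wt S)
odd-wt-∷ false S = refl
odd-wt-∷ true  S = odd-suc (wt S)

Lin-flip : ∀ {n} (x S : Vec Bool n) → Lin n (flip x S) ≡ Lin n x xor odd (wt S)
Lin-flip []       []      = refl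
Lin-flip (x ∷ xs) (s ∷ S) = begin
  (x xor s) xor Lin _ (flip xs S)            ≡⟨ cong ((x xor s) xor_) (Lin-flip xs S) ⟩
  (x xor s) xor (Lin _ xs xor odd (wt S))    ≡⟨ xor-interchange x s (Lin _ xs) (odd (wt S)) ⟩
  (x xor Lin _ xs) xor (s xor odd (wt S))    ≡⟨ cong ((x xor Lin _ xs) xor_) (odd-wt-∷ s S) ⟨
  (x xor Lin _ xs) xor odd (wt (s ∷ S))      ∎
  where open ≡-Reasoning

xor-∧-self : ∀ u x → x xor (u ∧ x) ≡ not u ∧ x
xor-∧-self false x = xor-identityʳ x
xor-∧-self true  x = xor-same x

Lin-xor-dot : ∀ {n} (x u : Vec Bool n) → Lin n x xor dot u x ≡ dot (∁ u) x
Lin-xor-dot []       []       = refl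
Lin-xor-dot (x ∷ xs) (u ∷ us) = begin
  (x xor Lin _ xs) xor ((u ∧ x) xor dot us xs)   ≡⟨ xor-interchange x (Lin _ xs) (u ∧ x) (dot us xs) ⟩
  (x xor (u ∧ x)) xor (Lin _ xs xor dot us xs)   ≡⟨ cong₂ _xor_ (xor-∧-self u x) (Lin-xor-dot xs us) ⟩
  (not u ∧ x) xor dot (∁ us) xs                  ∎
  where open ≡-Reasoning

⊕L-flip : ∀ {n} (f : BoolFun n) x S → f x ≢ f (flip x S) →
  (f ⊕L) (flip x S) ≡ not ((f ⊕L) x xor odd (wt S))
⊕L-flip {n} f x S fx≢fy = begin
  f (flip x S) xor Lin n (flip x S)          ≡⟨ cong₂ _xor_ (¬-not (≢-sym fx≢fy)) (Lin-flip x S) ⟩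
  not (f x) xor (Lin n x xor odd (wt S))     ≡⟨ not-distribˡ-xor (f x) _ ⟨
  not (f x xor (Lin n x xor odd (wt S)))     ≡⟨ cong not (xor-assoc (f x) (Lin n x) (odd (wt S))) ⟨
  not ((f x xor Lin n x) xor odd (wt S))     ∎
  where open ≡-Reasoning

≡not-xor-parity : ∀ {b c} o → c ≡ not (b xor o) → (o ≡ false → b ≢ c) × (o ≡ true → b ≡ c)
≡not-xor-parity {false} false refl = (λ _ ()) , (λ ())
≡not-xor-parity {true}  false refl = (λ _ ()) , (λ ())
≡not-xor-parity {false} true  refl = (λ ()) , (λ _ → refl)
≡not-xor-parity {true}  true  refl = (λ ()) , (λ _ → refl)

sensitive⇒dualSensitive-⊕L : ∀ {n} (f : BoolFun n) k → Sensitive f k → DualSensitive (f ⊕L) k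
sensitive⇒dualSensitive-⊕L f k (x , sensitive) = x , λ S 1≤|S| |S|≤k →
  ≡not-xor-parity (odd (wt S)) (⊕L-flip f x S (sensitive S 1≤|S| |S|≤k))

∑ : {A : Set} → List A → (A → ℚ) → ℚ
∑ L F = sumℚ (map F L)

infix 5 ∑
syntax ∑ L (λ x → e) = ∑[ x ← L ] e

module _ {A : Set} where

  ∑-++ : ∀ (xs ys : List A) F → ∑ (xs ++ ys) F ≡ ∑ xs F + ∑ ys F
  ∑-++ []       ys F = sym (ℚP.+-identityˡ _)
  ∑-++ (x ∷ xs) ys F = trans (cong (_+_ (F x)) (∑-++ xs ys F)) (sym (ℚP.+-assoc (F x) _ _))

  ∑-cong : ∀ (L : List A) {F G} → (∀ x → F x ≡ G x) → ∑ L F ≡ ∑ L G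
  ∑-cong L F≗G = cong sumℚ (ListP.map-cong F≗G L)

  ∑-zero : ∀ (L : List A) {F} → (∀ x → F x ≡ 0ℚ) → ∑ L F ≡ 0ℚ
  ∑-zero []      F≗0 = refl
  ∑-zero (x ∷ L) F≗0 = cong₂ _+_ (F≗0 x) (∑-zero L F≗0)

  ∑-*ˡ : ∀ (L : List A) a F → ∑[ x ← L ] a * F x ≡ a * ∑ L F
  ∑-*ˡ []      a F = sym (ℚP.*-zeroʳ a)
  ∑-*ˡ (x ∷ L) a F = trans (cong (_+_ (a * F x)) (∑-*ˡ L a F)) (sym (ℚP.*-distribˡ-+ a _ _))

  ∑-+ : ∀ (L : List A) F G → ∑[ x ← L ] (F x + G x) ≡ ∑ L F + ∑ L G
  ∑-+ []      F G = refl
  ∑-+ (x ∷ L) F G = trans (cong (_+_ (F x + G x)) (∑-+ L F G)) (+-interchange (F x) (G x) _ _)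

∑-comm : {A B : Set} (L : List A) (M : List B) (H : A → B → ℚ) →
  ∑[ x ← L ] ∑[ y ← M ] H x y ≡ ∑[ y ← M ] ∑[ x ← L ] H x y
∑-comm []      M H = sym (∑-zero M (λ _ → refl))
∑-comm (x ∷ L) M H = trans (cong (_+_ (∑ M (H x))) (∑-comm L M H)) (sym (∑-+ M (H x) _))

∑-map : {A B : Set} (g : A → B) (L : List A) (F : B → ℚ) → ∑ (map g L) F ≡ ∑[ x ← L ] F (g x)
∑-map g L F = cong sumℚ (sym (ListP.map-∘ L))

∑-allVecs-suc : ∀ n (F : Vec Bool (ℕ.suc n) → ℚ) →
  ∑ (allVecs (ℕ.suc n)) F ≡ (∑[ x ← allVecs n ] F (false ∷ x)) + (∑[ x ← allVecs n ] F (true ∷ x))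
∑-allVecs-suc n F =
  trans (∑-++ (map (false ∷_) (allVecs n)) _ F)
        (cong₂ _+_ (∑-map (false ∷_) (allVecs n) F) (∑-map (true ∷_) (allVecs n) F))

fromℤ : ℤ.ℤ → ℚ
fromℤ z = mkℚ z 0 (Coprimality.sym (1-coprimeTo _))

fromℤ-+ : ∀ a b → fromℤ (a ℤ.+ b) ≡ fromℤ a + fromℤ b
fromℤ-+ a b = ℚP.toℚᵘ-injective (ℚᵘP.≃-sym (ℚᵘP.≃-trans (ℚP.toℚᵘ-homo-+ (fromℤ a) (fromℤ b)) (ℚᵘ.*≡* eq)))
  where
  eq : ((a ℤ.* + 1) ℤ.+ (b ℤ.* + 1)) ℤ.* + 1 ≡ (a ℤ.+ b) ℤ.* + 1
  eq = cong (ℤ._* + 1) (cong₂ ℤ._+_ (ℤP.*-identityʳ a) (ℤP.*-identityʳ b))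

fromℤ-sumℤ : ∀ zs → fromℤ (sumℤ zs) ≡ sumℚ (map fromℤ zs)
fromℤ-sumℤ []       = refl
fromℤ-sumℤ (z ∷ zs) = trans (fromℤ-+ z (sumℤ zs)) (cong (_+_ (fromℤ z)) (fromℤ-sumℤ zs))

sgnℚ : Bool → ℚ
sgnℚ = fromℤ ∘ sgn

sgnℚ-xor : ∀ a b → sgnℚ (a xor b) ≡ sgnℚ a * sgnℚ b
sgnℚ-xor false false = refl
sgnℚ-xor false true  = refl
sgnℚ-xor true  false = refl
sgnℚ-xor true  true  = refl

-2ℚ : ℚ
-2ℚ = ℚ.- (1ℚ + 1ℚ)

sgnℚ-xor-bit : ∀ a b → sgnℚ (a xor b) ≡ sgnℚ b + -2ℚ * (sgnℚ b * bitℚ a)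
sgnℚ-xor-bit false false = refl
sgnℚ-xor-bit false true  = refl
sgnℚ-xor-bit true  false = refl
sgnℚ-xor-bit true  true  = refl

walshℚ : ∀ {n} → BoolFun n → Vec Bool n → ℚ
walshℚ {n} f v = ∑[ x ← allVecs n ] sgnℚ (f x xor dot v x)

fromℤ-walsh : ∀ {n} (f : BoolFun n) v → fromℤ (walsh f v) ≡ walshℚ f v
fromℤ-walsh {n} f v = trans (fromℤ-sumℤ (map signs (allVecs n))) (∑-map signs (allVecs n) fromℤ)
  where
  signs : Vec Bool n → ℤ.ℤ
  signs x = sgn (f x xor dot v x)

monomial₁ : Bool → Bool → ℚ
monomial₁ false b = 1ℚ
monomial₁ true  b = bitℚ b

monomial-∷ : ∀ {n} s b (S x : Vec Bool n) → monomial (s ∷ S) (b ∷ x) ≡ monomial₁ s b * monomial S x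
monomial-∷ false b S x = sym (ℚP.*-identityˡ _)
monomial-∷ true  b S x = refl

monomial-∅ : ∀ {n} (x : Vec Bool n) → monomial (replicate n false) x ≡ 1ℚ
monomial-∅ []       = refl
monomial-∅ (b ∷ x) = monomial-∅ x

characterSum : ∀ {n} → Vec Bool n → Vec Bool n → ℚ
characterSum {n} S v = ∑[ x ← allVecs n ] sgnℚ (dot v x) * monomial S x

characterSum₁ : Bool → Bool → ℚ
characterSum₁ s w = sgnℚ (w ∧ false) * monomial₁ s false + sgnℚ (w ∧ true) * monomial₁ s true

characterSum-∷ : ∀ {n} s w (S v : Vec Bool n) →
  characterSum (s ∷ S) (w ∷ v) ≡ characterSum₁ s w * characterSum S v
characterSum-∷ {n} s w S v = begin
  characterSum (s ∷ S) (w ∷ v)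
    ≡⟨ ∑-allVecs-suc n _ ⟩
  (∑[ x ← allVecs n ] term false x) + (∑[ x ← allVecs n ] term true x)
    ≡⟨ cong₂ _+_ (∑-cong (allVecs n) (term-factors false)) (∑-cong (allVecs n) (term-factors true)) ⟩
  (∑[ x ← allVecs n ] factor false * summand x) + (∑[ x ← allVecs n ] factor true * summand x)
    ≡⟨ cong₂ _+_ (∑-*ˡ (allVecs n) (factor false) summand) (∑-*ˡ (allVecs n) (factor true) summand) ⟩
  factor false * characterSum S v + factor true * characterSum S v
    ≡⟨ ℚP.*-distribʳ-+ (characterSum S v) (factor false) (factor true) ⟨
  characterSum₁ s w * characterSum S v
    ∎
  where
  open ≡-Reasoning
  term : Bool → Vec Bool n → ℚ
  term b x = sgnℚ (dot (w ∷ v) (b ∷ x)) * monomial (s ∷ S) (b ∷ x)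
  factor : Bool → ℚ
  factor b = sgnℚ (w ∧ b) * monomial₁ s b
  summand : Vec Bool n → ℚ
  summand x = sgnℚ (dot v x) * monomial S x
  term-factors : ∀ b x → term b x ≡ factor b * summand x
  term-factors b x =
    trans (cong₂ _*_ (sgnℚ-xor (w ∧ b) (dot v x)) (monomial-∷ s b S x))
          (*-interchange (sgnℚ (w ∧ b)) (sgnℚ (dot v x)) (monomial₁ s b) (monomial S x))

x≡0⇒y*x≡0 : ∀ y {x} → x ≡ 0ℚ → y * x ≡ 0ℚ
x≡0⇒y*x≡0 y refl = ℚP.*-zeroʳ y

characterSum-vanishes : ∀ {n} (S v : Vec Bool n) → wt S ℕ.< wt v → characterSum S v ≡ 0ℚ
-- In the first clause characterSum₁ false true computes to 1 + (-1) = 0ℚ.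
characterSum-vanishes (false ∷ S) (true ∷ v) _ =
  trans (characterSum-∷ false true S v) (ℚP.*-zeroˡ (characterSum S v))
characterSum-vanishes (false ∷ S) (false ∷ v) |S|<|v| =
  trans (characterSum-∷ false false S v) (x≡0⇒y*x≡0 (characterSum₁ false false) (characterSum-vanishes S v |S|<|v|))
characterSum-vanishes (true ∷ S) (true ∷ v) (ℕ.s≤s |S|<|v|) =
  trans (characterSum-∷ true true S v) (x≡0⇒y*x≡0 (characterSum₁ true true) (characterSum-vanishes S v |S|<|v|))
characterSum-vanishes (true ∷ S) (false ∷ v) 1+|S|<|v| =
  trans (characterSum-∷ true false S v)
        (x≡0⇒y*x≡0 (characterSum₁ true false) (characterSum-vanishes S v (ℕP.<-trans (ℕP.n<1+n _) 1+|S|<|v|)))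

correlation-vanishes : ∀ {n} (f : BoolFun n) p → PdegAtMost f p → ∀ v → p ℕ.< wt v →
  ∑[ x ← allVecs n ] sgnℚ (dot v x) * bitℚ (f x) ≡ 0ℚ
correlation-vanishes {n} f p (c , c-vanishes , c-represents) v p<|v| = begin
  ∑[ x ← points ] sgnℚ (dot v x) * bitℚ (f x)
    ≡⟨ ∑-cong points (λ x → cong (sgnℚ (dot v x) *_) (sym (c-represents x))) ⟩
  ∑[ x ← points ] sgnℚ (dot v x) * (∑[ S ← points ] c S * monomial S x)
    ≡⟨ ∑-cong points (λ x → sym (∑-*ˡ points (sgnℚ (dot v x)) _)) ⟩
  ∑[ x ← points ] ∑[ S ← points ] sgnℚ (dot v x) * (c S * monomial S x)
    ≡⟨ ∑-comm points points _ ⟩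
  ∑[ S ← points ] ∑[ x ← points ] sgnℚ (dot v x) * (c S * monomial S x)
    ≡⟨ ∑-cong points (λ S → ∑-cong points (λ x → *-left-comm (sgnℚ (dot v x)) (c S) _)) ⟩
  ∑[ S ← points ] ∑[ x ← points ] c S * (sgnℚ (dot v x) * monomial S x)
    ≡⟨ ∑-cong points (λ S → ∑-*ˡ points (c S) _) ⟩
  ∑[ S ← points ] c S * characterSum S v
    ≡⟨ ∑-zero points term-vanishes ⟩
  0ℚ
    ∎
  where
  open ≡-Reasoning
  points = allVecs n
  term-vanishes : ∀ S → c S * characterSum S v ≡ 0ℚ
  term-vanishes S with p ℕ.<? wt S
  ... | yes p<|S| = trans (cong (_* characterSum S v) (c-vanishes S p<|S|)) (ℚP.*-zeroˡ (characterSum S v))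
  ... | no  p≮|S| = x≡0⇒y*x≡0 (c S) (characterSum-vanishes S v (ℕP.≤-<-trans (ℕP.≮⇒≥ p≮|S|) p<|v|))

wt-replicate-false : ∀ n → wt (replicate n false) ≡ 0
wt-replicate-false ℕ.zero    = refl
wt-replicate-false (ℕ.suc n) = wt-replicate-false n

walshℚ-vanishes : ∀ {n} (f : BoolFun n) p → PdegAtMost f p → ∀ v → p ℕ.< wt v → walshℚ f v ≡ 0ℚ
walshℚ-vanishes {n} f p pdeg v p<|v| = begin
  walshℚ f v
    ≡⟨ ∑-cong points (λ x → sgnℚ-xor-bit (f x) (dot v x)) ⟩
  ∑[ x ← points ] (sgnℚ (dot v x) + -2ℚ * (sgnℚ (dot v x) * bitℚ (f x)))
    ≡⟨ ∑-+ points _ _ ⟩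
  (∑[ x ← points ] sgnℚ (dot v x)) + (∑[ x ← points ] -2ℚ * (sgnℚ (dot v x) * bitℚ (f x)))
    ≡⟨ cong₂ _+_ constant-part-vanishes (trans (∑-*ˡ points -2ℚ _) (x≡0⇒y*x≡0 -2ℚ correlation-part-vanishes)) ⟩
  0ℚ + 0ℚ
    ≡⟨ ℚP.+-identityˡ 0ℚ ⟩
  0ℚ
    ∎
  where
  open ≡-Reasoning
  points = allVecs n
  correlation-part-vanishes : ∑[ x ← points ] sgnℚ (dot v x) * bitℚ (f x) ≡ 0ℚ
  correlation-part-vanishes = correlation-vanishes f p pdeg v p<|v|
  constant-part-vanishes : ∑[ x ← points ] sgnℚ (dot v x) ≡ 0ℚ
  constant-part-vanishes =
    trans (∑-cong points (λ x → trans (sym (ℚP.*-identityʳ _)) (cong (sgnℚ (dot v x) *_) (sym (monomial-∅ x)))))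
          (characterSum-vanishes (replicate n false) v
            (subst (ℕ._< wt v) (sym (wt-replicate-false n)) (ℕP.≤-<-trans ℕ.z≤n p<|v|)))

walsh-vanishes : ∀ {n} (f : BoolFun n) p → PdegAtMost f p → ∀ v → p ℕ.< wt v → walsh f v ≡ + 0
walsh-vanishes f p pdeg v p<|v| = cong ↥_ (trans (fromℤ-walsh f v) (walshℚ-vanishes f p pdeg v p<|v|))

walsh-⊕L : ∀ {n} (f : BoolFun n) u → walsh (f ⊕L) u ≡ walsh f (∁ u)
walsh-⊕L {n} f u = cong sumℤ (ListP.map-cong (cong sgn ∘ exponents-agree) (allVecs n))
  where
  exponents-agree : ∀ x → (f x xor Lin n x) xor dot u x ≡ f x xor dot (∁ u) x
  exponents-agree x = trans (xor-assoc (f x) (Lin n x) (dot u x)) (cong (f x xor_) (Lin-xor-dot x u))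

wt-∁ : ∀ {n} (u : Vec Bool n) → wt u ℕ.+ wt (∁ u) ≡ n
wt-∁ []          = refl
wt-∁ (false ∷ u) = trans (ℕP.+-suc _ _) (cong ℕ.suc (wt-∁ u))
wt-∁ (true ∷ u)  = cong ℕ.suc (wt-∁ u)

+≤n-p-1⇒+1+p≤n : ∀ n p w → + w ℤ.≤ (+ n - + p) - + 1 → w ℕ.+ ℕ.suc p ℕ.≤ n
+≤n-p-1⇒+1+p≤n n p w w≤n-p-1 =
  ℤP.drop‿+≤+ (subst (+ (w ℕ.+ ℕ.suc p) ℤ.≤_) n-p-1+1+p≡n (ℤP.+-monoˡ-≤ (+ ℕ.suc p) w≤n-p-1))
  where
  open +-*-Solver
  n-p-1+1+p≡n : ((+ n - + p) - + 1) ℤ.+ (+ 1 ℤ.+ + p) ≡ + n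
  n-p-1+1+p≡n = solve 2 (λ n p → ((n :- p) :- con (+ 1)) :+ (con (+ 1) :+ p) := n) refl (+ n) (+ p)

p<wt-∁ : ∀ {n} p (u : Vec Bool n) → + wt u ℤ.≤ (+ n - + p) - + 1 → p ℕ.< wt (∁ u)
p<wt-∁ {n} p u |u|≤n-p-1 = ℕP.+-cancelˡ-≤ (wt u) (ℕ.suc p) (wt (∁ u))
  (subst (wt u ℕ.+ ℕ.suc p ℕ.≤_) (sym (wt-∁ u)) (+≤n-p-1⇒+1+p≤n n p (wt u) |u|≤n-p-1))

pdeg⇒resilient-⊕L : ∀ {n} (f : BoolFun n) p → PdegAtMost f p → Resilient (f ⊕L) ((+ n - + p) - + 1)
pdeg⇒resilient-⊕L f p pdeg u |u|≤n-p-1 =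
  trans (walsh-⊕L f u) (walsh-vanishes f p pdeg (∁ u) (p<wt-∁ p u |u|≤n-p-1))

mainTheorem2 : ∀ (n k p : ℕ) (f : BoolFun n) → NKPFunction n k p f →
    NKMFunction n k ((+ n - + p) - + 1) (f ⊕L)
mainTheorem2 n k p f (sensitive , pdeg) =
  sensitive⇒dualSensitive-⊕L f k sensitive , pdeg⇒resilient-⊕L f p pdeg
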